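{- Let $\#$ be a parametrized monad on a category $\mathbf{C}$ with finite coproducts, and let $f:A\to B$ be a morphism of complete Elgot $\#$-algebras from $(A,a,(-)^\dagger)$ to $(B,b,(-)^\ddagger)$. Then $f$ is a morphism of $\#$-algebras, i.e. $f\circ a=b\circ(f\# f)$.
   Context: A parametrized monad is a bifunctor $\#:\mathbf{C}\times\mathbf{C}\to\mathbf{C}$ such that each $(-)\#X$ is a monad with unit $u^X_A:A\to A\#X$ and multiplication $m^X_A:(A\#X)\#X\to A\#X$, and for each $f:X\to Y$ the family $(\mathrm{id}_Z\#f)_Z$ is a monad morphism. A $\#$-algebra is $(A,a)$ with $a:A\#A\to A$, $a\circ u^A_A=\mathrm{id}$, $a\circ(a\#\mathrm{id})=a\circ m^A_A$. A complete Elgot $\#$-algebra is a $\#$-algebra $(A,a)$ with an operator sending each $e:X\to A\#X$ to $e^\dagger:X\to A$ such that: (solution) $e^\dagger=a\circ(\mathrm{id}_A\#e^\dagger)\circ e$; (functoriality) for $e:X\to A\#X$, $f:Y\to A\#Y$, $h:X\to Y$, if $f\circ h=(\mathrm{id}_A\#h)\circ e$ then $f^\dagger\circ h=e^\dagger$; (compositionality) for $f:Y\to A\#Y$ and $g:X\to Y\#X$, putting $f^\dagger\bullet g=(f^\dagger\#\mathrm{id}_X)\circ g$ and $f\blacksquare g=m^{Y+X}_A\circ(((\mathrm{id}_A\#\mathsf{inl})\circ f)\#\mathsf{inr})\circ[u^X_Y,g]:Y+X\to A\#(Y+X)$, one has $(f\blacksquare g)^\dagger\circ\mathsf{inr}=(f^\dagger\bullet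 g)^\dagger$. A morphism of complete Elgot $\#$-algebras $(A,a,\dagger)\to(B,b,\ddagger)$ is $f:A\to B$ such that $((f\#\mathrm{id}_X)\circ e)^\ddagger=f\circ e^\dagger$ for all $e:X\to A\#X$. -}

module Defs where

open import Level using (Level; _⊔_; suc)
open import Relation.Binary.PropositionalEquality using (_≡_)

record Category (o ℓ : Level) : Set (suc (o ⊔ ℓ)) where
  infixr 9 _∘_
  field
    Obj : Set o
    Hom : Obj → Obj → Set ℓ
    id  : ∀ {A} → Hom A A
    _∘_ : ∀ {A B C} → Hom B C → Hom A B → Hom A C
    identityˡ : ∀ {A B} {f : Hom A B} → id ∘ f ≡ f
    identityʳ : ∀ {A B} {f : Hom A B} → f ∘ id ≡ f
    assoc : ∀ {A B C D} {f : Hom A B} {g : Hom B C} {h : Hom C D} →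
            (h ∘ g) ∘ f ≡ h ∘ (g ∘ f)

record FiniteCoproducts {o ℓ} (C : Category o ℓ) : Set (o ⊔ ℓ) where
  open Category C
  infixr 6 _+_
  field
    ⊥ : Obj
    ¡ : ∀ {A} → Hom ⊥ A
    ¡-unique : ∀ {A} (h : Hom ⊥ A) → h ≡ ¡
    _+_ : Obj → Obj → Obj
    inl : ∀ {A B} → Hom A (A + B)
    inr : ∀ {A B} → Hom B (A + B)
    [_,_] : ∀ {A B D} → Hom A D → Hom B D → Hom (A + B) D
    inl-[] : ∀ {A B D} {f : Hom A D} {g : Hom B D} → [ f , g ] ∘ inl ≡ f
    inr-[] : ∀ {A B D} {f : Hom A D} {g : Hom B D} → [ f , g ] ∘ inr ≡ g
    []-unique : ∀ {A B D} {f : Hom A D} {g : Hom B D} (h : Hom (A + B) D) →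
                h ∘ inl ≡ f → h ∘ inr ≡ g → h ≡ [ f , g ]

record ParametrizedMonad {o ℓ} (C : Category o ℓ) : Set (o ⊔ ℓ) where
  open Category C
  infixl 7 _#_ _#₁_
  field
    _#_  : Obj → Obj → Obj
    _#₁_ : ∀ {A B X Y} → Hom A B → Hom X Y → Hom (A # X) (B # Y)
    #-identity : ∀ {A X} → id {A} #₁ id {X} ≡ id
    #-homomorphism : ∀ {A B D X Y Z} {f : Hom A B} {g : Hom B D} {h : Hom X Y} {k : Hom Y Z} →
                     (g ∘ f) #₁ (k ∘ h) ≡ (g #₁ k) ∘ (f #₁ h)
    u : ∀ X A → Hom A (A # X)
    m : ∀ X A → Hom ((A # X) # X) (A # X)
    u-natural : ∀ {X A B} {f : Hom A B} → (f #₁ id {X}) ∘ u X A ≡ u X B ∘ f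
    m-natural : ∀ {X A B} {f : Hom A B} →
                (f #₁ id {X}) ∘ m X A ≡ m X B ∘ ((f #₁ id) #₁ id)
    m-assoc : ∀ {X A} → m X A ∘ (m X A #₁ id) ≡ m X A ∘ m X (A # X)
    m-unitˡ : ∀ {X A} → m X A ∘ u X (A # X) ≡ id
    m-unitʳ : ∀ {X A} → m X A ∘ (u X A #₁ id) ≡ id
    -- for each f : X → Y, (id # f) is a monad morphism ((-) # X) → ((-) # Y)
    -- (its naturality in A is an instance of bifunctoriality)
    mor-u : ∀ {X Y A} {f : Hom X Y} → (id {A} #₁ f) ∘ u X A ≡ u Y A
    mor-m : ∀ {X Y A} {f : Hom X Y} →
            (id {A} #₁ f) ∘ m X A ≡ m Y A ∘ ((id #₁ f) #₁ f)

module _ {o ℓ} {C : Category o ℓ} (CP : FiniteCoproducts C) (P : ParametrizedMonad C) where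
  open Category C
  open FiniteCoproducts CP
  open ParametrizedMonad P

  IsAlgebra : (A : Obj) → Hom (A # A) A → Set ℓ
  IsAlgebra A a = (a ∘ u A A ≡ id) × (a ∘ (a #₁ id) ≡ a ∘ m A A)
    where open import Data.Product using (_×_)

  _•_ : ∀ {A X Y} → Hom Y A → Hom X (Y # X) → Hom X (A # X)
  f† • g = (f† #₁ id) ∘ g

  _■_ : ∀ {A X Y} → Hom Y (A # Y) → Hom X (Y # X) → Hom (Y + X) (A # (Y + X))
  _■_ {A} {X} {Y} f g = m (Y + X) A ∘ (((id #₁ inl) ∘ f) #₁ inr) ∘ [ u X Y , g ]

  record CompleteElgotAlgebra : Set (o ⊔ ℓ) where
    field
      A : Obj
      a : Hom (A # A) A
      algebra : IsAlgebra A a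
      _† : ∀ {X} → Hom X (A # X) → Hom X A
      solution : ∀ {X} (e : Hom X (A # X)) → e † ≡ a ∘ (id #₁ (e †)) ∘ e
      functoriality : ∀ {X Y} (e : Hom X (A # X)) (f : Hom Y (A # Y)) (h : Hom X Y) →
                      f ∘ h ≡ (id #₁ h) ∘ e → (f †) ∘ h ≡ e †
      compositionality : ∀ {X Y} (f : Hom Y (A # Y)) (g : Hom X (Y # X)) →
                         ((f ■ g) †) ∘ inr ≡ ((f †) • g) †

  open CompleteElgotAlgebra

  IsElgotMorphism : (𝔸 𝔹 : CompleteElgotAlgebra) → Hom (A 𝔸) (A 𝔹) → Set (o ⊔ ℓ)
  IsElgotMorphism 𝔸 𝔹 f = ∀ {X} (e : Hom X (A 𝔸 # X)) → _†_ 𝔹 ((f #₁ id) ∘ e) ≡ f ∘ _†_ 𝔸 e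
    where _†_ : (𝔼 : CompleteElgotAlgebra) → ∀ {X} → Hom X (A 𝔼 # X) → Hom X (A 𝔼)
          _†_ 𝔼 = CompleteElgotAlgebra._† 𝔼

  IsAlgebraMorphism : (𝔸 𝔹 : CompleteElgotAlgebra) → Hom (A 𝔸) (A 𝔹) → Set ℓ
  IsAlgebraMorphism 𝔸 𝔹 f = f ∘ a 𝔸 ≡ a 𝔹 ∘ (f #₁ f)

-- The structure map of a complete Elgot #-algebra is determined by its solution
-- operator: for the equation e = [ id # inr , u ] on A # A + A, the solution satisfies
-- e† ∘ inr = id and hence e† ∘ inl = a. An Elgot morphism f preserves solutions, so
-- f ∘ a = f ∘ e† ∘ inl = ((f # id) ∘ e)‡ ∘ inl, and unfolding the latter solution once
-- in B gives b ∘ (f # f).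
module Submission where

open import Defs
open import Data.Product using (proj₁)
open import Relation.Binary.PropositionalEquality using (_≡_; sym; trans; cong; cong₂; module ≡-Reasoning)

module _ {o ℓ} {C : Category o ℓ} (P : ParametrizedMonad C) where
  open Category C
  open ParametrizedMonad P

  #₁-∘-#₁ : ∀ {A B D X Y Z} {f : Hom B D} {g : Hom Y Z} {h : Hom A B} {k : Hom X Y} →
            (f #₁ g) ∘ (h #₁ k) ≡ (f ∘ h) #₁ (g ∘ k)
  #₁-∘-#₁ = sym #-homomorphism

module _ {o ℓ} {C : Category o ℓ} (CP : FiniteCoproducts C) (P : ParametrizedMonad C) where
  open Category C
  open FiniteCoproducts CP
  open ParametrizedMonad P
  open ≡-Reasoning

  algebraEquation : (A : Obj) → Hom (A # A + A) (A # (A # A + A))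
  algebraEquation A = [ id #₁ inr , u (A # A + A) A ]

  module CompleteElgotAlgebraProperties (𝔼 : CompleteElgotAlgebra CP P) where
    open CompleteElgotAlgebra 𝔼 public

    †-∘-unit : ∀ {X Y} {e : Hom X (A # X)} {k : Hom Y X} {g : Hom Y A} →
               e ∘ k ≡ u X A ∘ g → e † ∘ k ≡ g
    †-∘-unit {X} {e = e} {k} {g} ek≡ug = begin
      e † ∘ k                          ≡⟨ cong (_∘ k) (solution e) ⟩
      (a ∘ (id #₁ e †) ∘ e) ∘ k        ≡⟨ assoc ⟩
      a ∘ ((id #₁ e †) ∘ e) ∘ k        ≡⟨ cong (a ∘_) assoc ⟩
      a ∘ (id #₁ e †) ∘ e ∘ k          ≡⟨ cong (λ z → a ∘ (id #₁ e †) ∘ z) ek≡ug ⟩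
      a ∘ (id #₁ e †) ∘ u X A ∘ g      ≡⟨ cong (a ∘_) (sym assoc) ⟩
      a ∘ ((id #₁ e †) ∘ u X A) ∘ g    ≡⟨ cong (λ z → a ∘ z ∘ g) mor-u ⟩
      a ∘ u A A ∘ g                    ≡⟨ sym assoc ⟩
      (a ∘ u A A) ∘ g                  ≡⟨ cong (_∘ g) (proj₁ algebra) ⟩
      id ∘ g                           ≡⟨ identityˡ ⟩
      g                                ∎

    †-∘-#₁ : ∀ {X Y Z} {e : Hom X (A # X)} {k : Hom (Z # Y) X} {g : Hom Z A} {h : Hom Y X} →
             e ∘ k ≡ g #₁ h → e † ∘ k ≡ a ∘ (g #₁ (e † ∘ h))
    †-∘-#₁ {e = e} {k} {g} {h} ek≡gh = begin
      e † ∘ k                          ≡⟨ cong (_∘ k) (solution e) ⟩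
      (a ∘ (id #₁ e †) ∘ e) ∘ k        ≡⟨ assoc ⟩
      a ∘ ((id #₁ e †) ∘ e) ∘ k        ≡⟨ cong (a ∘_) assoc ⟩
      a ∘ (id #₁ e †) ∘ e ∘ k          ≡⟨ cong (λ z → a ∘ (id #₁ e †) ∘ z) ek≡gh ⟩
      a ∘ (id #₁ e †) ∘ (g #₁ h)       ≡⟨ cong (a ∘_) (#₁-∘-#₁ P) ⟩
      a ∘ ((id ∘ g) #₁ (e † ∘ h))      ≡⟨ cong (λ z → a ∘ (z #₁ (e † ∘ h))) identityˡ ⟩
      a ∘ (g #₁ (e † ∘ h))             ∎

    algebraEquation†∘inr≡id : algebraEquation A † ∘ inr ≡ id
    algebraEquation†∘inr≡id = †-∘-unit (trans inr-[] (sym identityʳ))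

    algebraEquation†∘inl≡a : algebraEquation A † ∘ inl ≡ a
    algebraEquation†∘inl≡a = begin
      algebraEquation A † ∘ inl                    ≡⟨ †-∘-#₁ inl-[] ⟩
      a ∘ (id #₁ (algebraEquation A † ∘ inr))      ≡⟨ cong (λ z → a ∘ (id #₁ z)) algebraEquation†∘inr≡id ⟩
      a ∘ (id #₁ id)                               ≡⟨ cong (a ∘_) #-identity ⟩
      a ∘ id                                       ≡⟨ identityʳ ⟩
      a                                            ∎

proposition4p12 : ∀ {o ℓ} {C : Category o ℓ} (CP : FiniteCoproducts C) (P : ParametrizedMonad C)
                    (𝔸 𝔹 : CompleteElgotAlgebra CP P) (f : Category.Hom C (CompleteElgotAlgebra.A 𝔸) (CompleteElgotAlgebra.A 𝔹)) →
                    IsElgotMorphism CP P 𝔸 𝔹 f → IsAlgebraMorphism CP P 𝔸 𝔹 f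
proposition4p12 {C = C} CP P 𝔸 𝔹 f preserves† = begin
  f ∘ 𝔸.a                  ≡⟨ cong (f ∘_) (sym 𝔸.algebraEquation†∘inl≡a) ⟩
  f ∘ e 𝔸.† ∘ inl          ≡⟨ sym assoc ⟩
  (f ∘ e 𝔸.†) ∘ inl        ≡⟨ cong (_∘ inl) (sym (preserves† e)) ⟩
  d ∘ inl                  ≡⟨ 𝔹.†-∘-#₁ fe∘inl≡f#inr ⟩
  𝔹.a ∘ (f #₁ (d ∘ inr))   ≡⟨ cong (λ z → 𝔹.a ∘ (f #₁ z)) d∘inr≡f ⟩
  𝔹.a ∘ (f #₁ f)           ∎
  where
    open Category C
    open FiniteCoproducts CP
    open ParametrizedMonad P
    open ≡-Reasoning
    module 𝔸 = CompleteElgotAlgebraProperties CP P 𝔸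
    module 𝔹 = CompleteElgotAlgebraProperties CP P 𝔹
    e : Hom (𝔸.A # 𝔸.A + 𝔸.A) (𝔸.A # (𝔸.A # 𝔸.A + 𝔸.A))
    e = algebraEquation CP P 𝔸.A

    d : Hom (𝔸.A # 𝔸.A + 𝔸.A) 𝔹.A
    d = ((f #₁ id) ∘ e) 𝔹.†

    fe∘inl≡f#inr : ((f #₁ id) ∘ e) ∘ inl ≡ f #₁ inr
    fe∘inl≡f#inr = begin
      ((f #₁ id) ∘ e) ∘ inl   ≡⟨ assoc ⟩
      (f #₁ id) ∘ e ∘ inl     ≡⟨ cong ((f #₁ id) ∘_) inl-[] ⟩
      (f #₁ id) ∘ (id #₁ inr) ≡⟨ #₁-∘-#₁ P ⟩
      (f ∘ id) #₁ (id ∘ inr)  ≡⟨ cong₂ _#₁_ identityʳ identityˡ ⟩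
      f #₁ inr                ∎

    d∘inr≡f : d ∘ inr ≡ f
    d∘inr≡f = begin
      d ∘ inr               ≡⟨ cong (_∘ inr) (preserves† e) ⟩
      (f ∘ e 𝔸.†) ∘ inr     ≡⟨ assoc ⟩
      f ∘ e 𝔸.† ∘ inr       ≡⟨ cong (f ∘_) 𝔸.algebraEquation†∘inr≡id ⟩
      f ∘ id                ≡⟨ identityʳ ⟩
      f                     ∎
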